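{- Let $f$ be an endomorphism of $\{a,b\}^*$, where the alphabet is ordered by $a \prec b$, and assume $f$ is prolongable on $a$. If $f^\omega(a)$ is an infinite Lyndon word, then $f$ preserves the lexicographic order on finite words.
   Context: The lexicographic order $\prec$ on finite and infinite words over $\{a \prec b\}$: $u \prec v$ iff $u$ is a proper prefix of $v$ (when $u$ is finite), or $u = x\alpha y$, $v = x\beta z$ with letters $\alpha \prec \beta$. A non-empty finite word $w$ is a Lyndon word if $w \prec s$ for every non-empty proper suffix $s$ of $w$. An infinite word is an infinite Lyndon word if it has infinitely many prefixes that are Lyndon words. A morphism $f$ is prolongable on $a$ if $f(a) = au$ for some word $u$ and $|f^n(a)| \to \infty$; then $f^\omega(a)$ denotes the unique infinite word having every $f^n(a)$ as a prefix. $f$ preserves the lexicographic order on finite words if for all finite words $u,v$, $u \prec v$ implies $f(u) \prec f(v)$. -}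

module Defs where

open import Data.Nat using (ℕ; zero; suc; _≤_; _<_)
open import Data.List using (List; []; _∷_; _++_; length; concatMap)
open import Data.Product using (Σ; _×_; ∃-syntax)
open import Relation.Binary.PropositionalEquality using (_≡_)
open import Relation.Nullary using (¬_)

data Letter : Set where
  a b : Letter

data _<ₗ_ : Letter → Letter → Set where
  a<b : a <ₗ b

Word : Set
Word = List Letter

data _≺_ : Word → Word → Set where
  prefix : ∀ {α v} → [] ≺ (α ∷ v)
  differ : ∀ {α β u v} → α <ₗ β → (α ∷ u) ≺ (β ∷ v)
  same   : ∀ {α u v} → u ≺ v → (α ∷ u) ≺ (α ∷ v)

Lyndon : Word → Set
Lyndon w = ¬ (w ≡ []) × (∀ p s → p ++ s ≡ w → ¬ (p ≡ []) → ¬ (s ≡ []) → w ≺ s)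

InfWord : Set
InfWord = ℕ → Letter

pref : InfWord → ℕ → Word
pref x zero = []
pref x (suc n) = x 0 ∷ pref (λ i → x (suc i)) n

InfLyndon : InfWord → Set
InfLyndon x = ∀ m → ∃[ n ] (m ≤ n × Lyndon (pref x n))

record Morphism : Set where
  constructor morph
  field
    img : Letter → Word

apply : Morphism → Word → Word
apply f w = concatMap (Morphism.img f) w

iter : ℕ → Morphism → Word → Word
iter zero f w = w
iter (suc n) f w = apply f (iter n f w)

Prolongable : Morphism → Set
Prolongable f = (∃[ u ] (Morphism.img f a ≡ a ∷ u))
              × (∀ m → ∃[ n ] (m ≤ length (iter n f (a ∷ []))))

IsPrefixOf : Word → InfWord → Set
IsPrefixOf w x = pref x (length w) ≡ w

-- x is f^ω(a): every f^n(a) is a prefix of x (unique when f is prolongable on a)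
IsFixedPointFrom : Morphism → InfWord → Set
IsFixedPointFrom f x = ∀ n → IsPrefixOf (iter n f (a ∷ [])) x

PreservesLex : Morphism → Set
PreservesLex f = ∀ u v → u ≺ v → apply f u ≺ apply f v

{-# OPTIONS --safe #-}
module Submission where

-- Let x be an infinite word smaller than each of its proper suffixes (which is what
-- being an infinite Lyndon word amounts to), and let g be a non-erasing morphism such
-- that x has prefixes g(a y b z) with z arbitrarily long.  Put A = g(a), B = g(b).
-- If A and B first differ with A carrying the letter a, then g preserves the order.
-- They cannot first differ the other way round: an occurrence of B inside x would then
-- be smaller than the prefix A of x.  Nor can A = B, since x would be a power of A.
-- If B = A s, then g factors through the order-preserving morphism a ↦ a, b ↦ ab as
-- (a ↦ A, b ↦ s); if A = B s, it factors through the Fibonacci morphism a ↦ ab, b ↦ a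
-- as (a ↦ B, b ↦ s).  The factor (A, s) resp. (B, s) inherits the hypotheses, so by
-- induction on |A| + |B| it preserves the order.  In the second case this is
-- impossible: the Fibonacci image of a y b c z contains aa… after the prefix ab, and
-- an order-preserving (B, s) maps it below the image of ab, a factor of x smaller
-- than a prefix of x.  Finally, f^ω(a) has the prefixes f(f^n(a)), and f(b) is not
-- empty since otherwise f^ω(a) would be a power of f(a).

open import Defs
open import Data.Nat using (ℕ; zero; suc; _+_; _≤_; _<_; z≤n; s≤s)
open import Data.Nat.Properties
open import Data.Nat.Induction using (<-wellFounded)
open import Induction.WellFounded using (Acc; acc)
open import Data.List using ([]; _∷_; _++_; length)
open import Data.List.Properties
  using (++-assoc; ++-identityʳ; ++-conicalˡ; length-++; length-++-≤ʳ; concatMap-++)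
open import Data.Product using (_×_; _,_; ∃-syntax)
open import Data.Empty using (⊥-elim)
open import Function using (_∘_)
open import Relation.Binary.PropositionalEquality
open import Relation.Binary.Definitions using (tri<; tri≈; tri>)
open import Relation.Nullary using (¬_)

open Morphism using (img)

a≢b : a ≢ b
a≢b ()

tail∞ : InfWord → InfWord
tail∞ X i = X (suc i)

drop∞ : ℕ → InfWord → InfWord
drop∞ n X i = X (n + i)

infix 4 _⊑_

data _⊑_ : Word → InfWord → Set where
  []  : ∀ {X} → [] ⊑ X
  _∷_ : ∀ {c w X} → X 0 ≡ c → w ⊑ tail∞ X → c ∷ w ⊑ X

⊑-++⁻ˡ : ∀ u {v X} → u ++ v ⊑ X → u ⊑ X
⊑-++⁻ˡ []      _       = []
⊑-++⁻ˡ (c ∷ u) (e ∷ p) = e ∷ ⊑-++⁻ˡ u p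

⊑-++⁻ʳ : ∀ u {v X} → u ++ v ⊑ X → v ⊑ drop∞ (length u) X
⊑-++⁻ʳ []      p       = p
⊑-++⁻ʳ (c ∷ u) (_ ∷ p) = ⊑-++⁻ʳ u p

⊑-agree : ∀ u {X Y j} → u ⊑ X → u ⊑ Y → j < length u → X j ≡ Y j
⊑-agree (c ∷ u) {j = zero}  (e ∷ _) (e′ ∷ _) _        = trans e (sym e′)
⊑-agree (c ∷ u) {j = suc j} (_ ∷ p) (_ ∷ q)  (s≤s j<) = ⊑-agree u p q j<

pref-⊑ : ∀ X n → pref X n ⊑ X
pref-⊑ X zero    = []
pref-⊑ X (suc n) = refl ∷ pref-⊑ (tail∞ X) n

IsPrefixOf⇒⊑ : ∀ {w X} → IsPrefixOf w X → w ⊑ X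
IsPrefixOf⇒⊑ {w} {X} e = subst (_⊑ X) e (pref-⊑ X (length w))

length-pref : ∀ X n → length (pref X n) ≡ n
length-pref X zero    = refl
length-pref X (suc n) = cong suc (length-pref (tail∞ X) n)

pref-++ : ∀ X m n → pref X (m + n) ≡ pref X m ++ pref (drop∞ m X) n
pref-++ X zero    n = refl
pref-++ X (suc m) n = cong (X 0 ∷_) (pref-++ (tail∞ X) m n)

pref-split : ∀ X j r → ∃[ y ] ∃[ z ] (length z ≡ r × pref X (j + suc r) ≡ y ++ X j ∷ z)
pref-split X zero    r = [] , pref (tail∞ X) r , length-pref (tail∞ X) r , refl
pref-split X (suc j) r with pref-split (tail∞ X) j r
... | y , z , |z|≡r , e = X 0 ∷ y , z , |z|≡r , cong (X 0 ∷_) e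

infix 4 _<∞_

_<∞_ : InfWord → InfWord → Set
X <∞ Y = ∃[ j ] ((∀ i → i < j → X i ≡ Y i) × X j ≡ a × Y j ≡ b)

<∞-asym : ∀ {X Y} → X <∞ Y → ¬ (Y <∞ X)
<∞-asym (j , agree , Xj≡a , Yj≡b) (k , agree′ , Yk≡a , Xk≡b) with <-cmp j k
... | tri< j<k _ _  = a≢b (trans (sym Xj≡a) (trans (sym (agree′ j j<k)) Yj≡b))
... | tri≈ _ refl _ = a≢b (trans (sym Xj≡a) Xk≡b)
... | tri> _ _ k<j  = a≢b (trans (sym Yk≡a) (trans (sym (agree k k<j)) Xk≡b))

ShiftMinimal : InfWord → Set
ShiftMinimal X = ∀ P → X <∞ drop∞ (suc P) X

infix 4 _⋖_

data _⋖_ : Word → Word → Set where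
  here  : ∀ {u v} → a ∷ u ⋖ b ∷ v
  there : ∀ {c u v} → u ⋖ v → c ∷ u ⋖ c ∷ v

⋖-++ʳ : ∀ {u v} r → u ⋖ v → u ++ r ⋖ v
⋖-++ʳ r here      = here
⋖-++ʳ r (there q) = there (⋖-++ʳ r q)

⋖⇒≺-++ : ∀ {u v} r t → u ⋖ v → (u ++ r) ≺ (v ++ t)
⋖⇒≺-++ r t here      = differ a<b
⋖⇒≺-++ r t (there q) = same (⋖⇒≺-++ r t q)

≺⇒⋖ : ∀ {u v} → u ≺ v → length v ≤ length u → u ⋖ v
≺⇒⋖ prefix       ()
≺⇒⋖ (differ a<b) _             = here
≺⇒⋖ (same u≺v)   (s≤s |v|≤|u|) = there (≺⇒⋖ u≺v |v|≤|u|)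

data Comparison (u v : Word) : Set where
  lt-mismatch : u ⋖ v → Comparison u v
  gt-mismatch : v ⋖ u → Comparison u v
  equal       : u ≡ v → Comparison u v
  lt-prefix   : ∀ s → s ≢ [] → v ≡ u ++ s → Comparison u v
  gt-prefix   : ∀ s → s ≢ [] → u ≡ v ++ s → Comparison u v

compare-∷ : ∀ c {u v} → Comparison u v → Comparison (c ∷ u) (c ∷ v)
compare-∷ c (lt-mismatch q)    = lt-mismatch (there q)
compare-∷ c (gt-mismatch q)    = gt-mismatch (there q)
compare-∷ c (equal e)          = equal (cong (c ∷_) e)
compare-∷ c (lt-prefix s ne e) = lt-prefix s ne (cong (c ∷_) e)
compare-∷ c (gt-prefix s ne e) = gt-prefix s ne (cong (c ∷_) e)

compare : ∀ u v → Comparison u v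
compare []      []      = equal refl
compare []      (c ∷ v) = lt-prefix (c ∷ v) (λ ()) refl
compare (c ∷ u) []      = gt-prefix (c ∷ u) (λ ()) refl
compare (a ∷ u) (a ∷ v) = compare-∷ a (compare u v)
compare (a ∷ u) (b ∷ v) = lt-mismatch here
compare (b ∷ u) (a ∷ v) = gt-mismatch here
compare (b ∷ u) (b ∷ v) = compare-∷ b (compare u v)

⋖⇒<∞ : ∀ {u v X Y} → u ⋖ v → u ⊑ X → v ⊑ Y → X <∞ Y
⋖⇒<∞ here (X0≡a ∷ _) (Y0≡b ∷ _) = 0 , (λ _ ()) , X0≡a , Y0≡b
⋖⇒<∞ {X = X} {Y} (there q) (X0≡c ∷ p) (Y0≡c ∷ p′) with ⋖⇒<∞ q p p′
... | j , agree , Xj≡a , Yj≡b = suc j , agree′ , Xj≡a , Yj≡b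
  where
  agree′ : ∀ i → i < suc j → X i ≡ Y i
  agree′ zero    _         = trans X0≡c (sym Y0≡c)
  agree′ (suc i) (s≤s i<j) = agree i i<j

≺-++ˡ : ∀ w {u v} → u ≺ v → (w ++ u) ≺ (w ++ v)
≺-++ˡ []      u≺v = u≺v
≺-++ˡ (c ∷ w) u≺v = same (≺-++ˡ w u≺v)

[]≺-++ : ∀ {u} v → u ≢ [] → [] ≺ (u ++ v)
[]≺-++ {[]}    v u≢[] = ⊥-elim (u≢[] refl)
[]≺-++ {c ∷ u} v _    = prefix

infLyndon⇒shiftMinimal : ∀ {X} → InfLyndon X → ShiftMinimal X
infLyndon⇒shiftMinimal {X} lyndon P with lyndon (suc (suc P))
... | n , 2+P≤n , _ , smallest with m≤n⇒∃[o]m+o≡n 2+P≤n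
... | r , refl = ⋖⇒<∞ (≺⇒⋖ w≺s |s|≤|w|) (pref-⊑ X n) (pref-⊑ (drop∞ (suc P) X) (suc r))
  where
  split : suc P + suc r ≡ suc (suc P) + r
  split = +-suc (suc P) r
  s : Word
  s = pref (drop∞ (suc P) X) (suc r)
  w≺s : pref X (suc (suc P) + r) ≺ s
  w≺s = smallest (pref X (suc P)) s
          (trans (sym (pref-++ X (suc P) (suc r))) (cong (pref X) split)) (λ ()) (λ ())
  |s|≤|w| : length s ≤ length (pref X (suc (suc P) + r))
  |s|≤|w| = subst₂ _≤_ (sym (length-pref (drop∞ (suc P) X) (suc r))) (sym (length-pref X _))
              (subst (suc r ≤_) split (m≤n+m (suc r) (suc P)))

shiftMinimal⇒¬⋖ : ∀ {X} → ShiftMinimal X → ∀ {u} r {v} → u ≢ [] → u ++ r ++ v ⊑ X → ¬ (v ⋖ u)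
shiftMinimal⇒¬⋖ _ {[]} _ u≢[] _ = ⊥-elim (u≢[] refl)
shiftMinimal⇒¬⋖ {X} minimal {c ∷ u} r {v} _ u++r++v⊑X v⋖u =
  <∞-asym (minimal (length (u ++ r))) (⋖⇒<∞ v⋖u v⊑later (⊑-++⁻ˡ (c ∷ u) u++r++v⊑X))
  where
  v⊑later : v ⊑ drop∞ (suc (length (u ++ r))) X
  v⊑later = ⊑-++⁻ʳ (c ∷ u ++ r) (subst (_⊑ X) (sym (++-assoc (c ∷ u) r v)) u++r++v⊑X)

power : ℕ → Word → Word
power zero    A = []
power (suc k) A = A ++ power k A

power-+ : ∀ m n A → power (m + n) A ≡ power m A ++ power n A
power-+ zero    n A = refl
power-+ (suc m) n A = trans (cong (A ++_) (power-+ m n A)) (sym (++-assoc A (power m A) _))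

power-suc : ∀ k A → power (suc k) A ≡ power k A ++ A
power-suc k A = trans (cong (λ n → power n A) (+-comm 1 k))
                      (trans (power-+ k 1 A) (cong (power k A ++_) (++-identityʳ A)))

shiftMinimal⇒aperiodic : ∀ {X A} → ShiftMinimal X → A ≢ [] →
                         ¬ (∀ N → ∃[ k ] (N ≤ length (power k A) × power k A ⊑ X))
shiftMinimal⇒aperiodic {A = []} _ A≢[] _ = A≢[] refl
shiftMinimal⇒aperiodic {X} {c ∷ A} minimal _ longPowers with minimal (length A)
... | j , _ , Xj≡a , Xj+|cA|≡b with longPowers (suc (length (c ∷ A) + j))
... | zero    , () , _
... | suc k , |cA|+j<|power| , power⊑X =
  a≢b (trans (sym Xj≡a) (trans (⊑-agree (power k (c ∷ A)) initial shifted j<) Xj+|cA|≡b))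
  where
  initial : power k (c ∷ A) ⊑ X
  initial = ⊑-++⁻ˡ (power k (c ∷ A)) (subst (_⊑ X) (power-suc k (c ∷ A)) power⊑X)
  shifted : power k (c ∷ A) ⊑ drop∞ (length (c ∷ A)) X
  shifted = ⊑-++⁻ʳ (c ∷ A) power⊑X
  j< : j < length (power k (c ∷ A))
  j< = +-cancelˡ-< (length (c ∷ A)) j _
         (subst (suc (length (c ∷ A) + j) ≤_) (length-++ (c ∷ A)) |cA|+j<|power|)

NonErasing : Morphism → Set
NonErasing g = ∀ c → img g c ≢ []

fromImages : Word → Word → Morphism
fromImages A B = morph λ { a → A ; b → B }

size : Morphism → ℕ
size g = length (img g a) + length (img g b)

apply-++ : ∀ g u v → apply g (u ++ v) ≡ apply g u ++ apply g v
apply-++ g = concatMap-++ (img g)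

apply-factor : ∀ {g g′ m} → (∀ c → img g c ≡ apply g′ (img m c)) →
               apply g ≗ apply g′ ∘ apply m
apply-factor e []                     = refl
apply-factor {g′ = g′} {m} e (c ∷ w) =
  trans (cong₂ _++_ (e c) (apply-factor e w)) (sym (apply-++ g′ (img m c) (apply m w)))

length-<-++ : ∀ (u v : Word) → u ≢ [] → length v < length (u ++ v)
length-<-++ []      v u≢[] = ⊥-elim (u≢[] refl)
length-<-++ (c ∷ u) v _    = s≤s (length-++-≤ʳ v {u})

0<length : ∀ {u : Word} → u ≢ [] → 0 < length u
0<length {[]}    u≢[] = ⊥-elim (u≢[] refl)
0<length {c ∷ u} _    = s≤s z≤n

length-apply : ∀ {g} → NonErasing g → ∀ w → length w ≤ length (apply g w)
length-apply     ne []      = z≤n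
length-apply {g} ne (c ∷ w) =
  ≤-trans (s≤s (length-apply ne w)) (length-<-++ (img g c) (apply g w) (ne c))

images-powers : ∀ {g A} → (∀ c → ∃[ k ] (img g c ≡ power k A)) →
                ∀ w → ∃[ k ] (apply g w ≡ power k A)
images-powers pow []                   = 0 , refl
images-powers {A = A} pow (c ∷ w) with pow c | images-powers pow w
... | k , e | l , e′ = k + l , trans (cong₂ _++_ e e′) (sym (power-+ k l A))

preservesLex-∘ : ∀ {g g′ m} → apply g ≗ apply g′ ∘ apply m →
                 PreservesLex g′ → PreservesLex m → PreservesLex g
preservesLex-∘ g≗ g′-mono m-mono u v u≺v =
  subst₂ _≺_ (sym (g≗ u)) (sym (g≗ v)) (g′-mono _ _ (m-mono u v u≺v))

⋖⇒preservesLex : ∀ {g} → NonErasing g → img g a ⋖ img g b → PreservesLex g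
⋖⇒preservesLex ne q _ _ (prefix {α})   = []≺-++ _ (ne α)
⋖⇒preservesLex ne q _ _ (differ a<b)   = ⋖⇒≺-++ _ _ q
⋖⇒preservesLex {g} ne q _ _ (same {α} u≺v) = ≺-++ˡ (img g α) (⋖⇒preservesLex ne q _ _ u≺v)

insertA : Morphism
insertA = fromImages (a ∷ []) (a ∷ b ∷ [])

fibonacci : Morphism
fibonacci = fromImages (a ∷ b ∷ []) (a ∷ [])

insertA-nonErasing : NonErasing insertA
insertA-nonErasing a ()
insertA-nonErasing b ()

fibonacci-nonErasing : NonErasing fibonacci
fibonacci-nonErasing a ()
fibonacci-nonErasing b ()

insertA-preservesLex : PreservesLex insertA
insertA-preservesLex _ _ (prefix {α})        = []≺-++ _ (insertA-nonErasing α)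
insertA-preservesLex _ _ (differ {u = u} a<b) = same (insertA-≺b u)
  where
  insertA-≺b : ∀ u {v} → apply insertA u ≺ (b ∷ v)
  insertA-≺b []      = prefix
  insertA-≺b (a ∷ _) = differ a<b
  insertA-≺b (b ∷ _) = differ a<b
insertA-preservesLex _ _ (same {α} u≺v) =
  ≺-++ˡ (img insertA α) (insertA-preservesLex _ _ u≺v)

insertA-factor : ∀ {g s} → img g b ≡ img g a ++ s →
                 apply g ≗ apply (fromImages (img g a) s) ∘ apply insertA
insertA-factor {g} {s} e = apply-factor λ
  { a → sym (++-identityʳ (img g a))
  ; b → trans e (cong (img g a ++_) (sym (++-identityʳ s))) }

fibonacci-factor : ∀ {g s} → img g a ≡ img g b ++ s →
                   apply g ≗ apply (fromImages (img g b) s) ∘ apply fibonacci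
fibonacci-factor {g} {s} e = apply-factor λ
  { a → trans e (cong (img g b ++_) (sym (++-identityʳ s)))
  ; b → sym (++-identityʳ (img g b)) }

fibonacci-∷ : ∀ c w → ∃[ t ] (apply fibonacci (c ∷ w) ≡ a ∷ t × length w ≤ length t)
fibonacci-∷ a w = b ∷ apply fibonacci w , refl , m≤n⇒m≤1+n (length-apply fibonacci-nonErasing w)
fibonacci-∷ b w = apply fibonacci w , refl , length-apply fibonacci-nonErasing w

LongImagePrefixes : InfWord → Morphism → Set
LongImagePrefixes X g = ∀ n → ∃[ y ] ∃[ z ] (n ≤ length z × apply g (a ∷ y ++ b ∷ z) ⊑ X)

PreservesAnchors : Morphism → Set
PreservesAnchors m = ∀ y z → ∃[ y′ ] ∃[ z′ ]
  (length z ≤ length z′ × apply m (a ∷ y ++ b ∷ z) ≡ a ∷ y′ ++ b ∷ z′)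

longImagePrefixes-factor : ∀ {X g g′ m} → apply g ≗ apply g′ ∘ apply m → PreservesAnchors m →
                           LongImagePrefixes X g → LongImagePrefixes X g′
longImagePrefixes-factor {X} {g′ = g′} g≗ anchors long n with long n
... | y , z , n≤|z| , image⊑X with anchors y z
... | y′ , z′ , |z|≤|z′| , e =
  y′ , z′ , ≤-trans n≤|z| |z|≤|z′| ,
  subst (_⊑ X) (trans (g≗ (a ∷ y ++ b ∷ z)) (cong (apply g′) e)) image⊑X

insertA-preservesAnchors : PreservesAnchors insertA
insertA-preservesAnchors y z =
  apply insertA y ++ a ∷ [] , apply insertA z , length-apply insertA-nonErasing z ,
  cong (a ∷_) (trans (apply-++ insertA y (b ∷ z)) (sym (++-assoc (apply insertA y) (a ∷ []) _)))

fibonacci-preservesAnchors : PreservesAnchors fibonacci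
fibonacci-preservesAnchors y z =
  [] , apply fibonacci y ++ a ∷ apply fibonacci z ,
  ≤-trans (length-apply fibonacci-nonErasing z)
    (≤-trans (n≤1+n _) (length-++-≤ʳ (a ∷ apply fibonacci z) {apply fibonacci y})) ,
  cong (λ w → a ∷ b ∷ w) (apply-++ fibonacci y (b ∷ z))

¬⋖-images : ∀ {X g} → ShiftMinimal X → img g a ≢ [] → LongImagePrefixes X g →
            ¬ (img g b ⋖ img g a)
¬⋖-images {X} {g} minimal ga≢[] long gb⋖ga with long 0
... | y , z , _ , image⊑X =
  shiftMinimal⇒¬⋖ minimal (apply g y) ga≢[]
    (subst (_⊑ X) (cong (img g a ++_) (apply-++ g y (b ∷ z))) image⊑X)
    (⋖-++ʳ (apply g z) gb⋖ga)

distinct-images : ∀ {X g} → ShiftMinimal X → NonErasing g → LongImagePrefixes X g →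
                  img g a ≢ img g b
distinct-images {X} {g} minimal ne long ga≡gb = shiftMinimal⇒aperiodic minimal (ne a) longPowers
  where
  A : Word
  A = img g a
  single : ∀ c → ∃[ k ] (img g c ≡ power k A)
  single a = 1 , sym (++-identityʳ A)
  single b = 1 , trans (sym ga≡gb) (sym (++-identityʳ A))
  longPowers : ∀ N → ∃[ k ] (N ≤ length (power k A) × power k A ⊑ X)
  longPowers N with long N
  ... | y , z , N≤|z| , image⊑X with images-powers single (a ∷ y ++ b ∷ z)
  ... | k , image≡power =
    k , subst (λ w → N ≤ length w) image≡power
          (≤-trans N≤|z| (≤-trans (m≤n⇒m≤1+n (≤-trans (n≤1+n _) (length-++-≤ʳ (b ∷ z) {y})))
                                  (length-apply ne (a ∷ y ++ b ∷ z)))) ,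
    subst (_⊑ X) image≡power image⊑X

¬preservesLex-fibonacci-factor : ∀ {X g g′} → ShiftMinimal X → NonErasing g′ →
                                 apply g ≗ apply g′ ∘ apply fibonacci →
                                 LongImagePrefixes X g → ¬ PreservesLex g′
¬preservesLex-fibonacci-factor {X} {g} {g′} minimal ne g≗ long mono
  with long (suc (length (apply g′ (b ∷ []))))
... | y , []    , ()                  , _
... | y , c ∷ z , s≤s |g′b|≤|z| , image⊑X with fibonacci-∷ c z
... | t , fib≡at , |z|≤|t| =
  shiftMinimal⇒¬⋖ minimal (apply g′ (apply fibonacci y)) U≢[]
    (subst (_⊑ X) decomposition image⊑X)
    (≺⇒⋖ (mono (a ∷ a ∷ t) (a ∷ b ∷ []) (same (differ a<b))) |U|≤|W|)
  where
  U W : Word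
  U = apply g′ (a ∷ b ∷ [])
  W = apply g′ (a ∷ a ∷ t)
  U≢[] : U ≢ []
  U≢[] = ne a ∘ ++-conicalˡ (img g′ a) _
  -- |z| ≥ |g′(b)| makes W at least as long as U, so W ≺ U is decided by a mismatch.
  |U|≤|W| : length U ≤ length W
  |U|≤|W| = subst₂ _≤_ (sym (length-++ (img g′ a))) (sym (length-++ (img g′ a)))
    (+-monoʳ-≤ (length (img g′ a))
      (≤-trans |g′b|≤|z| (≤-trans |z|≤|t| (≤-trans (length-apply ne t)
        (length-++-≤ʳ (apply g′ t) {img g′ a})))))
  fibonacci-split : apply fibonacci (y ++ b ∷ c ∷ z) ≡ apply fibonacci y ++ a ∷ a ∷ t
  fibonacci-split = trans (apply-++ fibonacci y (b ∷ c ∷ z))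
                          (cong (λ w → apply fibonacci y ++ a ∷ w) fib≡at)
  decomposition : apply g (a ∷ y ++ b ∷ c ∷ z) ≡ U ++ apply g′ (apply fibonacci y) ++ W
  decomposition = begin
    apply g (a ∷ y ++ b ∷ c ∷ z)
      ≡⟨ g≗ (a ∷ y ++ b ∷ c ∷ z) ⟩
    apply g′ (a ∷ b ∷ apply fibonacci (y ++ b ∷ c ∷ z))
      ≡⟨ cong (λ w → apply g′ (a ∷ b ∷ w)) fibonacci-split ⟩
    apply g′ ((a ∷ b ∷ []) ++ apply fibonacci y ++ a ∷ a ∷ t)
      ≡⟨ apply-++ g′ (a ∷ b ∷ []) (apply fibonacci y ++ a ∷ a ∷ t) ⟩
    U ++ apply g′ (apply fibonacci y ++ a ∷ a ∷ t)
      ≡⟨ cong (U ++_) (apply-++ g′ (apply fibonacci y) (a ∷ a ∷ t)) ⟩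
    U ++ apply g′ (apply fibonacci y) ++ W
      ∎
    where open ≡-Reasoning

shiftMinimal⇒preservesLex : ∀ {X} → ShiftMinimal X → ∀ g → NonErasing g →
                            LongImagePrefixes X g → Acc _<_ (size g) → PreservesLex g
shiftMinimal⇒preservesLex minimal g ne long (acc smaller) with compare (img g a) (img g b)
... | lt-mismatch ga⋖gb = ⋖⇒preservesLex ne ga⋖gb
... | gt-mismatch gb⋖ga = ⊥-elim (¬⋖-images minimal (ne a) long gb⋖ga)
... | equal ga≡gb       = ⊥-elim (distinct-images minimal ne long ga≡gb)
... | lt-prefix s s≢[] gb≡ga++s =
  preservesLex-∘ factor
    (shiftMinimal⇒preservesLex minimal g′ ne′
      (longImagePrefixes-factor factor insertA-preservesAnchors long) (smaller size<))
    insertA-preservesLex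
  where
  g′ : Morphism
  g′ = fromImages (img g a) s
  ne′ : NonErasing g′
  ne′ a = ne a
  ne′ b = s≢[]
  factor : apply g ≗ apply g′ ∘ apply insertA
  factor = insertA-factor gb≡ga++s
  size< : size g′ < size g
  size< = +-monoʳ-< (length (img g a))
            (subst (length s <_) (cong length (sym gb≡ga++s)) (length-<-++ (img g a) s (ne a)))
... | gt-prefix s s≢[] ga≡gb++s =
  ⊥-elim (¬preservesLex-fibonacci-factor minimal ne′ factor long
    (shiftMinimal⇒preservesLex minimal g′ ne′
      (longImagePrefixes-factor factor fibonacci-preservesAnchors long) (smaller size<)))
  where
  g′ : Morphism
  g′ = fromImages (img g b) s
  ne′ : NonErasing g′
  ne′ a = ne b
  ne′ b = s≢[]
  factor : apply g ≗ apply g′ ∘ apply fibonacci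
  factor = fibonacci-factor ga≡gb++s
  size< : size g′ < size g
  size< = subst (_< size g) (trans (cong length ga≡gb++s) (length-++ (img g b)))
            (m<m+n (length (img g a)) (0<length (ne b)))

prolongable⇒img-a≢[] : ∀ {f} → Prolongable f → img f a ≢ []
prolongable⇒img-a≢[] ((_ , fa≡au) , _) fa≡[] with trans (sym fa≡au) fa≡[]
... | ()

fixedPoint⇒nonErasing : ∀ {f x} → Prolongable f → IsFixedPointFrom f x → ShiftMinimal x →
                        NonErasing f
fixedPoint⇒nonErasing prolongable _ _ a = prolongable⇒img-a≢[] prolongable
fixedPoint⇒nonErasing {f} {x} prolongable@(_ , grows) fix minimal b fb≡[] =
  shiftMinimal⇒aperiodic minimal (prolongable⇒img-a≢[] prolongable) longPowers
  where
  single : ∀ c → ∃[ k ] (img f c ≡ power k (img f a))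
  single a = 1 , sym (++-identityʳ (img f a))
  single b = 0 , fb≡[]
  longPowers : ∀ N → ∃[ k ] (N ≤ length (power k (img f a)) × power k (img f a) ⊑ x)
  longPowers N with grows (suc (suc N))
  ... | zero  , s≤s ()
  ... | suc m , 2+N≤|fᵐ⁺¹a| with images-powers single (iter m f (a ∷ []))
  ... | k , image≡power =
    k , subst (λ w → N ≤ length w) image≡power (m+n≤o⇒n≤o 2 2+N≤|fᵐ⁺¹a|) ,
    subst (_⊑ x) image≡power (IsPrefixOf⇒⊑ (fix (suc m)))

fixedPoint⇒image-pref-⊑ : ∀ {f x K} m → IsFixedPointFrom f x →
                          K ≤ length (iter m f (a ∷ [])) → apply f (pref x K) ⊑ x
fixedPoint⇒image-pref-⊑ {f} {x} {K} m fix K≤|fᵐa| with m≤n⇒∃[o]m+o≡n K≤|fᵐa|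
... | d , K+d≡|fᵐa| =
  ⊑-++⁻ˡ (apply f (pref x K)) (subst (_⊑ x) fᵐ⁺¹a-split (IsPrefixOf⇒⊑ (fix (suc m))))
  where
  fᵐ⁺¹a-split : iter (suc m) f (a ∷ []) ≡ apply f (pref x K) ++ apply f (pref (drop∞ K x) d)
  fᵐ⁺¹a-split = begin
    apply f (iter m f (a ∷ []))
      ≡⟨ cong (apply f) (sym (fix m)) ⟩
    apply f (pref x (length (iter m f (a ∷ []))))
      ≡⟨ cong (apply f ∘ pref x) (sym K+d≡|fᵐa|) ⟩
    apply f (pref x (K + d))
      ≡⟨ cong (apply f) (pref-++ x K d) ⟩
    apply f (pref x K ++ pref (drop∞ K x) d)
      ≡⟨ apply-++ f (pref x K) (pref (drop∞ K x) d) ⟩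
    apply f (pref x K) ++ apply f (pref (drop∞ K x) d)
      ∎
    where open ≡-Reasoning

fixedPoint⇒longImagePrefixes : ∀ {f x} → Prolongable f → IsFixedPointFrom f x → ShiftMinimal x →
                               LongImagePrefixes x f
-- x <∞ tail∞ x provides the letter b at position j + 1.
fixedPoint⇒longImagePrefixes {f} {x} (_ , grows) fix minimal n with minimal 0
... | j , _ , _ , x[1+j]≡b with grows (suc (j + suc n)) | pref-split (tail∞ x) j n
... | m , K≤|fᵐa| | y , z , |z|≡n , split =
  y , z , ≤-reflexive (sym |z|≡n) ,
  subst (λ w → apply f w ⊑ x) anchored (fixedPoint⇒image-pref-⊑ m fix K≤|fᵐa|)
  where
  x0≡a : x 0 ≡ a
  x0≡a with IsPrefixOf⇒⊑ {X = x} (fix 0)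
  ... | x0≡a ∷ [] = x0≡a
  anchored : pref x (suc (j + suc n)) ≡ a ∷ y ++ b ∷ z
  anchored = cong₂ _∷_ x0≡a (trans split (cong (λ c → y ++ c ∷ z) x[1+j]≡b))

proposition4 : (f : Morphism) → Prolongable f → (x : InfWord) →
               IsFixedPointFrom f x → InfLyndon x → PreservesLex f
proposition4 f prolongable x fix lyndon =
  shiftMinimal⇒preservesLex minimal f
    (fixedPoint⇒nonErasing prolongable fix minimal)
    (fixedPoint⇒longImagePrefixes prolongable fix minimal)
    (<-wellFounded (size f))
  where
  minimal : ShiftMinimal x
  minimal = infLyndon⇒shiftMinimal lyndon
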